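{- Let $w$ be a recurrent infinite word over $\mathcal{A}_N$. Then for each $m\in\mathbb{N}$ and $k\in\mathbb{N}$ one has $$\phi_k(A_{w_m})\cdot U_k(\mathrm{T}^m w)=U_k(w).$$
   Context: $p$ is a fixed prime; $\mathcal{A}_N=\{1,\ldots,N\}$. A word is recurrent if every finite factor occurring in it occurs infinitely often. $\mathrm{T}$ is the left shift; $w_n$ is the prefix of length $n$ of $w$ ($w_0$ the empty word). For $a\in\mathbb{N}$, $A_a=\begin{pmatrix}0&1\\1&a\end{pmatrix}$, and for a finite word $u=a_1\ldots a_n$, $A_u=A_{a_1}\cdots A_{a_n}$ (identity for the empty word). $\phi_k:\mathrm{SL}_2^\pm(\mathbb{Z})\to\mathrm{SL}_2^\pm(\mathbb{Z}/p^k\mathbb{Z})$ is reduction modulo $p^k$ (here $\mathrm{SL}_2^\pm$ denotes matrices of determinant $\pm1$). For an infinite word $v$, $U_k(v)=\{\phi_k(A_{v_n}):n\in\mathbb{Z}_{\ge0}\}$, and $B\cdot U$ denotes $\{BC: C\in U\}$. -}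

module Defs where

open import Data.Nat using (ℕ; zero; suc; _+_; _*_; _^_; _%_; _≥_; NonZero)
open import Data.Nat.Properties using (m^n≢0)
open import Data.Nat.Primality using (Prime; prime⇒nonZero)
open import Data.Fin using (Fin; toℕ)
open import Data.List using (List; []; _∷_; foldr; tabulate)
open import Data.Product using (∃-syntax; _×_)
open import Function.Bundles using (_⇔_)
open import Relation.Binary.PropositionalEquality using (_≡_)

record Mat : Set where
  constructor mat
  field
    a b c d : ℕ

_⊗_ : Mat → Mat → Mat
mat a b c d ⊗ mat a' b' c' d' =
  mat (a * a' + b * c') (a * b' + b * d') (c * a' + d * c') (c * b' + d * d')

I₂ : Mat
I₂ = mat 1 0 0 1

A : ℕ → Mat
A x = mat 0 1 1 x

A[_] : List ℕ → Mat
A[_] = foldr (λ x M → A x ⊗ M) I₂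

-- infinite words over the alphabet A_N = {1,...,N}; letter i : Fin N stands for 1 + toℕ i
InfWord : ℕ → Set
InfWord N = ℕ → Fin N

letter : {N : ℕ} → Fin N → ℕ
letter i = suc (toℕ i)

prefix : {N : ℕ} → InfWord N → ℕ → List ℕ
prefix w n = tabulate {n = n} (λ i → letter (w (toℕ i)))

shift : {N : ℕ} → ℕ → InfWord N → InfWord N
shift m w i = w (m + i)

SameFactor : {N : ℕ} → InfWord N → ℕ → ℕ → ℕ → Set
SameFactor w L i j = (t : Fin L) → w (j + toℕ t) ≡ w (i + toℕ t)

Recurrent : {N : ℕ} → InfWord N → Set
Recurrent w = ∀ (L i M : ℕ) → ∃[ j ] (j ≥ M × SameFactor w L i j)

module ModArith (q : ℕ) .{{_ : NonZero q}} where
  φ : Mat → Mat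
  φ (mat a b c d) = mat (a % q) (b % q) (c % q) (d % q)

  -- multiplication in M_2(ℤ/qℤ) on canonical representatives
  _·_ : Mat → Mat → Mat
  X · Y = φ (X ⊗ Y)

module USets (p k : ℕ) .{{nz : NonZero (p ^ k)}} where
  open ModArith (p ^ k)

  _∈U[_] : {N : ℕ} → Mat → InfWord N → Set
  X ∈U[ v ] = ∃[ n ] (φ A[ prefix v n ] ≡ X)

  _∈_·U[_] : {N : ℕ} → Mat → Mat → InfWord N → Set
  X ∈ B ·U[ v ] = ∃[ C ] ((C ∈U[ v ]) × (B · C ≡ X))

pk≢0 : {p : ℕ} → Prime p → (k : ℕ) → NonZero (p ^ k)
pk≢0 {p} pp k = m^n≢0 p k {{prime⇒nonZero pp}}

-- φ_k on matrices with natural entries (all A_u have such entries)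
φ[_,_] : {p : ℕ} → Prime p → ℕ → Mat → Mat
φ[_,_] {p} pp k = ModArith.φ (p ^ k) {{pk≢0 pp k}}

ShiftedSetEq : {N : ℕ} {p : ℕ} → Prime p → ℕ → Mat → InfWord N → InfWord N → Set
ShiftedSetEq {p = p} pp k B v w =
  ∀ X → (X ∈ φ[ pp , k ] B ·U[ v ]) ⇔ (X ∈U[ w ])
  where
    instance _ = pk≢0 pp k
    open USets p k

{-# OPTIONS --safe #-}
-- Cutting the prefix w_{m+n} at m gives φ(A_{w_m}) · U_k(T^m w) ⊆ U_k(w).  Conversely, for
-- X = φ(A_{w_n}) we need a j ≥ m with φ(A_{w_j}) = X.  Recurrence yields lengths L₀ = n < L₁ < ⋯
-- where w_{L_{i+1}} ends with a copy of w_{L_i} starting at a position ≥ m.  Among the finitely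
-- many residues φ(A_{w_{L_i}}) two coincide, say for i < j; then w_{L_j} = w_d w_{L_i} with d ≥ m,
-- so A_{w_d} A_{w_{L_i}} ≡ A_{w_{L_i}}, and invertibility modulo p^k gives A_{w_d} ≡ I.  Since
-- w_n is a prefix of w_{L_i}, also A_{w_{d+n}} = A_{w_d} A_{w_n} ≡ A_{w_n}, so j = d + n works.
module Submission where

open import Defs
open import Data.Nat using (ℕ; zero; suc; pred; _+_; _*_; _∸_; _^_; _%_; _≤_; _<_; NonZero)
open import Data.Nat.Properties
open import Data.Nat.DivMod using (%-distribˡ-+; %-distribˡ-*; m*n%n≡0; m%n<n)
open import Data.Nat.Primality using (Prime)
open import Data.Nat.Tactic.RingSolver using (solve-∀)
open import Data.Fin using (Fin; toℕ; fromℕ<; combine)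
open import Data.Fin.Properties using (toℕ-fromℕ<; toℕ<n; combine-injective; pigeonhole)
open import Data.List using (List; []; _∷_; _++_)
open import Data.List.Properties using (tabulate-cong)
open import Data.Product using (∃-syntax; _×_; _,_; proj₁)
open import Data.Sum using (inj₁; inj₂)
open import Function.Bundles using (mk⇔)
open import Relation.Binary.PropositionalEquality

mat-cong : ∀ {a b c d a' b' c' d'} → a ≡ a' → b ≡ b' → c ≡ c' → d ≡ d' →
           mat a b c d ≡ mat a' b' c' d'
mat-cong refl refl refl refl = refl

⊗-assoc : ∀ X Y Z → (X ⊗ Y) ⊗ Z ≡ X ⊗ (Y ⊗ Z)
⊗-assoc (mat a b c d) (mat a' b' c' d') (mat a'' b'' c'' d'') =
  mat-cong (entry a b a' b' c' d' a'' c'') (entry a b a' b' c' d' b'' d'')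
           (entry c d a' b' c' d' a'' c'') (entry c d a' b' c' d' b'' d'')
  where
    entry : ∀ x y u v r s e f →
            (x * u + y * r) * e + (x * v + y * s) * f ≡ x * (u * e + v * f) + y * (r * e + s * f)
    entry = solve-∀

⊗-identityˡ : ∀ X → I₂ ⊗ X ≡ X
⊗-identityˡ (mat a b c d) = mat-cong (lemma a c) (lemma b d) (lemma′ a c) (lemma′ b d)
  where
    lemma : ∀ x y → 1 * x + 0 * y ≡ x
    lemma = solve-∀
    lemma′ : ∀ x y → 0 * x + 1 * y ≡ y
    lemma′ = solve-∀

⊗-identityʳ : ∀ X → X ⊗ I₂ ≡ X
⊗-identityʳ (mat a b c d) = mat-cong (lemma a b) (lemma′ a b) (lemma c d) (lemma′ c d)
  where
    lemma : ∀ x y → x * 1 + y * 0 ≡ x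
    lemma = solve-∀
    lemma′ : ∀ x y → x * 0 + y * 1 ≡ y
    lemma′ = solve-∀

A[]-++ : ∀ u v → A[ u ++ v ] ≡ A[ u ] ⊗ A[ v ]
A[]-++ []      v = sym (⊗-identityˡ A[ v ])
A[]-++ (x ∷ u) v = trans (cong (A x ⊗_) (A[]-++ u v)) (sym (⊗-assoc (A x) A[ u ] A[ v ]))

prefix-+ : ∀ {N} (w : InfWord N) a b → prefix w (a + b) ≡ prefix w a ++ prefix (shift a w) b
prefix-+ w zero    b = refl
prefix-+ w (suc a) b = cong (letter (w 0) ∷_) (prefix-+ (shift 1 w) a b)

A-prefix-+ : ∀ {N} (w : InfWord N) a b →
             A[ prefix w (a + b) ] ≡ A[ prefix w a ] ⊗ A[ prefix (shift a w) b ]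
A-prefix-+ w a b = trans (cong A[_] (prefix-+ w a b)) (A[]-++ (prefix w a) _)

module _ {N : ℕ} (w : InfWord N) where

  sameFactor-at : ∀ {L i j} → SameFactor w L i j → ∀ {t} → t < L → w (j + t) ≡ w (i + t)
  sameFactor-at {i = i} {j} same t<L =
    subst (λ s → w (j + s) ≡ w (i + s)) (toℕ-fromℕ< t<L) (same (fromℕ< t<L))

  sameFactor-≤ : ∀ {L L' i j} → L' ≤ L → SameFactor w L i j → SameFactor w L' i j
  sameFactor-≤ L'≤L same t = sameFactor-at same (<-≤-trans (toℕ<n t) L'≤L)

  sameFactor-nested : ∀ {a d e} → SameFactor w (d + a) 0 e → SameFactor w a 0 d →
                      SameFactor w a 0 (e + d)
  sameFactor-nested {d = d} {e} outer inner t =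
    trans (cong w (+-assoc e d (toℕ t)))
          (trans (sameFactor-at outer (+-monoʳ-< d (toℕ<n t))) (inner t))

  prefix-sameFactor : ∀ {L d} → SameFactor w L 0 d → prefix (shift d w) L ≡ prefix w L
  prefix-sameFactor same = tabulate-cong (λ t → cong letter (same t))

  A-prefix-sameFactor : ∀ {L d} → SameFactor w L 0 d →
                        A[ prefix w (d + L) ] ≡ A[ prefix w d ] ⊗ A[ prefix w L ]
  A-prefix-sameFactor {L} {d} same =
    trans (A-prefix-+ w d L) (cong (λ u → A[ prefix w d ] ⊗ A[ u ]) (prefix-sameFactor same))

pigeonhole-ℕ : ∀ {n} (f : ℕ → Fin n) → ∃[ i ] ∃[ j ] (i < j × f i ≡ f j)
pigeonhole-ℕ {n} f with pigeonhole (n<1+n n) (λ i → f (toℕ i))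
... | i , j , i<j , fi≡fj = toℕ i , toℕ j , i<j , fi≡fj

module Congruence (q : ℕ) {{_ : NonZero q}} where
  open ModArith q

  infix 4 _≈_
  _≈_ : Mat → Mat → Set
  X ≈ Y = φ X ≡ φ Y

  %-distrib-+* : ∀ a b c d → (a * b + c * d) % q ≡ ((a % q) * (b % q) + (c % q) * (d % q)) % q
  %-distrib-+* a b c d = begin
    (a * b + c * d) % q
      ≡⟨ %-distribˡ-+ (a * b) (c * d) q ⟩
    ((a * b) % q + (c * d) % q) % q
      ≡⟨ cong₂ (λ x y → (x + y) % q) (%-distribˡ-* a b q) (%-distribˡ-* c d q) ⟩
    ((a % q) * (b % q) % q + (c % q) * (d % q) % q) % q
      ≡⟨ %-distribˡ-+ ((a % q) * (b % q)) ((c % q) * (d % q)) q ⟨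
    ((a % q) * (b % q) + (c % q) * (d % q)) % q
      ∎
    where open ≡-Reasoning

  φ-⊗ : ∀ X Y → φ (X ⊗ Y) ≡ φ X · φ Y
  φ-⊗ (mat a b c d) (mat a' b' c' d') =
    mat-cong (%-distrib-+* a a' b c') (%-distrib-+* a b' b d')
             (%-distrib-+* c a' d c') (%-distrib-+* c b' d d')

  ⊗-cong : ∀ {X X' Y Y'} → X ≈ X' → Y ≈ Y' → X ⊗ Y ≈ X' ⊗ Y'
  ⊗-cong {X} {X'} {Y} {Y'} X≈X' Y≈Y' =
    trans (φ-⊗ X Y) (trans (cong₂ _·_ X≈X' Y≈Y') (sym (φ-⊗ X' Y')))

  φ-A-prefix-+ : ∀ {N} (w : InfWord N) a b →
                 φ A[ prefix w a ] · φ A[ prefix (shift a w) b ] ≡ φ A[ prefix w (a + b) ]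
  φ-A-prefix-+ w a b = sym (trans (cong φ (A-prefix-+ w a b)) (φ-⊗ _ _))

  -- The inverse of (0 1 / 1 x) is (-x 1 / 1 0), and -x ≡ (q - 1) x modulo q.
  A⁻¹ : ℕ → Mat
  A⁻¹ x = mat (pred q * x) 1 1 0

  A[_]⁻¹ : List ℕ → Mat
  A[ [] ]⁻¹    = I₂
  A[ x ∷ u ]⁻¹ = A[ u ]⁻¹ ⊗ A⁻¹ x

  A-inverseʳ : ∀ x → A x ⊗ A⁻¹ x ≈ I₂
  A-inverseʳ x = mat-cong refl refl lower-left (cong (λ y → (1 + y) % q) (*-zeroʳ x))
    where
      open ≡-Reasoning
      lower-left : (1 * (pred q * x) + x * 1) % q ≡ 0 % q
      lower-left = begin
        (1 * (pred q * x) + x * 1) % q ≡⟨ cong (_% q) (cong₂ _+_ (*-identityˡ _) (*-identityʳ x)) ⟩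
        (pred q * x + x) % q           ≡⟨ cong (_% q) (+-comm (pred q * x) x) ⟩
        (suc (pred q) * x) % q         ≡⟨ cong (λ r → (r * x) % q) (suc-pred q) ⟩
        (q * x) % q                    ≡⟨ cong (_% q) (*-comm q x) ⟩
        (x * q) % q                    ≡⟨ m*n%n≡0 x q ⟩
        0                              ≡⟨ m*n%n≡0 0 q ⟨
        0 % q                          ∎

  A[]-inverseʳ : ∀ u → A[ u ] ⊗ A[ u ]⁻¹ ≈ I₂
  A[]-inverseʳ []      = cong φ (⊗-identityˡ I₂)
  A[]-inverseʳ (x ∷ u) = begin
    φ ((A x ⊗ A[ u ]) ⊗ (A[ u ]⁻¹ ⊗ A⁻¹ x)) ≡⟨ cong φ (⊗-assoc (A x) A[ u ] _) ⟩
    φ (A x ⊗ (A[ u ] ⊗ (A[ u ]⁻¹ ⊗ A⁻¹ x))) ≡⟨ cong (λ Y → φ (A x ⊗ Y)) (⊗-assoc A[ u ] A[ u ]⁻¹ (A⁻¹ x)) ⟨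
    φ (A x ⊗ ((A[ u ] ⊗ A[ u ]⁻¹) ⊗ A⁻¹ x)) ≡⟨ ⊗-cong {A x} refl (⊗-cong {A[ u ] ⊗ A[ u ]⁻¹} (A[]-inverseʳ u) refl) ⟩
    φ (A x ⊗ (I₂ ⊗ A⁻¹ x))                  ≡⟨ cong (λ Y → φ (A x ⊗ Y)) (⊗-identityˡ (A⁻¹ x)) ⟩
    φ (A x ⊗ A⁻¹ x)                         ≡⟨ A-inverseʳ x ⟩
    φ I₂                                    ∎
    where open ≡-Reasoning

  identityˡ-unique : ∀ G u → G ⊗ A[ u ] ≈ A[ u ] → G ≈ I₂
  identityˡ-unique G u GA≈A = begin
    φ G                              ≡⟨ cong φ (⊗-identityʳ G) ⟨
    φ (G ⊗ I₂)                       ≡⟨ ⊗-cong {G} refl (sym (A[]-inverseʳ u)) ⟩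
    φ (G ⊗ (A[ u ] ⊗ A[ u ]⁻¹))      ≡⟨ cong φ (⊗-assoc G A[ u ] A[ u ]⁻¹) ⟨
    φ ((G ⊗ A[ u ]) ⊗ A[ u ]⁻¹)      ≡⟨ ⊗-cong {G ⊗ A[ u ]} GA≈A refl ⟩
    φ (A[ u ] ⊗ A[ u ]⁻¹)            ≡⟨ A[]-inverseʳ u ⟩
    φ I₂                             ∎
    where open ≡-Reasoning

  residue : ℕ → Fin q
  residue x = fromℕ< (m%n<n x q)

  residue-injective : ∀ x y → residue x ≡ residue y → x % q ≡ y % q
  residue-injective x y eq =
    trans (sym (toℕ-fromℕ< (m%n<n x q))) (trans (cong toℕ eq) (toℕ-fromℕ< (m%n<n y q)))

  code : Mat → Fin (q * (q * (q * q)))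
  code (mat a b c d) = combine (residue a) (combine (residue b) (combine (residue c) (residue d)))

  code-injective : ∀ X Y → code X ≡ code Y → X ≈ Y
  code-injective (mat a b c d) (mat a' b' c' d') eq
    with a≡ , eq′  ← combine-injective _ _ _ _ eq
    with b≡ , eq″  ← combine-injective _ _ _ _ eq′
    with c≡ , d≡   ← combine-injective _ _ _ _ eq″
    = mat-cong (residue-injective a a' a≡) (residue-injective b b' b≡)
               (residue-injective c c' c≡) (residue-injective d d' d≡)

  pigeonhole-≈ : (F : ℕ → Mat) → ∃[ i ] ∃[ j ] (i < j × F i ≈ F j)
  pigeonhole-≈ F with i , j , i<j , eq ← pigeonhole-ℕ (λ i → code (F i))
    = i , j , i<j , code-injective (F i) (F j) eq

  module Returns {N : ℕ} (w : InfWord N) (recurrent : Recurrent w) (m : ℕ) where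

    -- proj₁ (recurrent L' 0 m) is a position ≥ m at which the prefix of length L' occurs again.
    returnLength : ℕ → ℕ → ℕ
    returnLength L zero    = L
    returnLength L (suc i) = proj₁ (recurrent (returnLength L i) 0 m) + returnLength L i

    returnLength-≥ : ∀ L i → L ≤ returnLength L i
    returnLength-≥ L zero    = ≤-refl
    returnLength-≥ L (suc i) = ≤-trans (returnLength-≥ L i) (m≤n+m _ _)

    returnLength-nested : ∀ L {i j} → i < j →
      ∃[ d ] (m ≤ d × returnLength L j ≡ d + returnLength L i × SameFactor w (returnLength L i) 0 d)
    returnLength-nested L {i} {suc j} i<1+j
      with e , m≤e , same ← recurrent (returnLength L j) 0 m
      with m≤n⇒m<n∨m≡n (≤-pred i<1+j)
    ... | inj₂ refl = e , m≤e , refl , same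
    ... | inj₁ i<j with d , _ , Lj≡d+Li , sameᵢ ← returnLength-nested L i<j =
      e + d , ≤-trans m≤e (m≤m+n e d) ,
      trans (cong (e +_) Lj≡d+Li) (sym (+-assoc e d _)) ,
      sameFactor-nested w (subst (λ r → SameFactor w r 0 e) Lj≡d+Li same) sameᵢ

    trivial-return : ∀ L → ∃[ d ] (m ≤ d × SameFactor w L 0 d × A[ prefix w d ] ≈ I₂)
    trivial-return L
      with i , j , i<j , Lᵢ≈Lⱼ ← pigeonhole-≈ (λ i → A[ prefix w (returnLength L i) ])
      with d , m≤d , Lj≡d+Li , same ← returnLength-nested L i<j
      = d , m≤d , sameFactor-≤ w (returnLength-≥ L i) same ,
        identityˡ-unique (A[ prefix w d ]) (prefix w Lᵢ) absorbs
      where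
        Lᵢ = returnLength L i
        absorbs : A[ prefix w d ] ⊗ A[ prefix w Lᵢ ] ≈ A[ prefix w Lᵢ ]
        absorbs = begin
          φ (A[ prefix w d ] ⊗ A[ prefix w Lᵢ ]) ≡⟨ cong φ (A-prefix-sameFactor w same) ⟨
          φ A[ prefix w (d + Lᵢ) ]               ≡⟨ cong (λ r → φ A[ prefix w r ]) Lj≡d+Li ⟨
          φ A[ prefix w (returnLength L j) ]     ≡⟨ Lᵢ≈Lⱼ ⟨
          φ A[ prefix w Lᵢ ]                     ∎
          where open ≡-Reasoning

  recurrent-late-prefix : ∀ {N} (w : InfWord N) → Recurrent w →
                          ∀ m n → ∃[ j ] (m ≤ j × A[ prefix w j ] ≈ A[ prefix w n ])
  recurrent-late-prefix w recurrent m n = late (Returns.trivial-return w recurrent m n)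
    where
      late : ∃[ d ] (m ≤ d × SameFactor w n 0 d × A[ prefix w d ] ≈ I₂) →
             ∃[ j ] (m ≤ j × A[ prefix w j ] ≈ A[ prefix w n ])
      late (d , m≤d , same , Ad≈I) = d + n , ≤-trans m≤d (m≤m+n d n) , (begin
        φ A[ prefix w (d + n) ]              ≡⟨ cong φ (A-prefix-sameFactor w same) ⟩
        φ (A[ prefix w d ] ⊗ A[ prefix w n ]) ≡⟨ ⊗-cong {A[ prefix w d ]} {I₂} {A[ prefix w n ]} {A[ prefix w n ]} Ad≈I refl ⟩
        φ (I₂ ⊗ A[ prefix w n ])             ≡⟨ cong φ (⊗-identityˡ A[ prefix w n ]) ⟩
        φ A[ prefix w n ]                    ∎)
        where open ≡-Reasoning

proposition3 : (p : ℕ) (pp : Prime p) (N : ℕ) (w : InfWord N) →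
    Recurrent w →
    (m k : ℕ) → ShiftedSetEq pp k A[ prefix w m ] (shift m w) w
proposition3 p pp N w recurrent m k X = mk⇔ to from
  where
    instance _ = pk≢0 pp k
    open USets p k
    open ModArith (p ^ k)
    open Congruence (p ^ k)

    to : X ∈ φ A[ prefix w m ] ·U[ shift m w ] → X ∈U[ w ]
    to (_ , (n , refl) , refl) = m + n , sym (φ-A-prefix-+ w m n)

    from : X ∈U[ w ] → X ∈ φ A[ prefix w m ] ·U[ shift m w ]
    from (n , refl) =
      let j , m≤j , Aj≈An = recurrent-late-prefix w recurrent m n in
      φ A[ prefix (shift m w) (j ∸ m) ] , (j ∸ m , refl) ,
      trans (φ-A-prefix-+ w m (j ∸ m)) (trans (cong (λ r → φ A[ prefix w r ]) (m+[n∸m]≡n m≤j)) Aj≈An)
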